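{- If an unroll tree $\mathbf{x}$ admits periodic patterns of sizes $p_1$ and $p_2$, then $\mathbf{x}$ admits a periodic pattern of size $\gcd(p_1,p_2)$.
   Context: For an FDDS $(S,f)$ ($S$ finite, $f:S\to S$) and a periodic state $u$ (one lying on a cycle), the unroll tree in $u$ is the infinite rooted tree with vertex set $\{(s,k)\mid k\in\mathbb{N},\ f^k(s)=u\}$, root $(u,0)$ and arcs $(v,k)\to(f(v),k-1)$; an unroll tree is any tree arising this way. It has exactly one infinite branch $w_0,w_1,w_2,\ldots$ ($w_0$ the root, $w_{i+1}$ a predecessor of $w_i$); let $\mathbf{t}_i$ be the finite tree consisting of $w_i$ and its descendants not in the subtree of $w_{i+1}$. A periodic pattern of size $p\ge1$ is a sequence $(\mathbf{t}_0,\ldots,\mathbf{t}_{p-1})$ such that $\mathbf{t}_i\cong\mathbf{t}_{i\bmod p}$ for all $i\in\mathbb{N}$. -}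

module Defs where

open import Data.Nat using (ℕ; zero; suc; _≤_; _%_; NonZero)
open import Data.Fin using (Fin)
open import Data.Fin.Properties using (_≟_)
open import Data.Bool using (Bool; T; not; _∧_)
open import Data.Product using (Σ; _×_; _,_; proj₁; proj₂)
open import Relation.Nullary.Decidable using (⌊_⌋)
open import Relation.Binary.PropositionalEquality using (_≡_)
open import Function.Bundles using (_⇔_)

-- An FDDS is (Fin n, f) with f : Fin n → Fin n.
-- k-fold iterate f^k.
iter : ∀ {n} → (Fin n → Fin n) → ℕ → Fin n → Fin n
iter f zero    s = s
iter f (suc k) s = f (iter f k s)

IsPeriodic : ∀ {n} → (Fin n → Fin n) → Fin n → Set
IsPeriodic f s = Σ ℕ λ k → iter f (suc k) s ≡ s

-- The infinite branch w_0, w_1, ... of the unroll tree of (f) in u: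
-- w_i = (v i , i) where v 0 = u, f (v (i+1)) = v i and every v i is periodic
-- (the unique such sequence; the infinite branch of the unroll tree).
IsInfiniteBranch : ∀ {n} → (Fin n → Fin n) → Fin n → (ℕ → Fin n) → Set
IsInfiniteBranch f u v =
  (v 0 ≡ u) × ((i : ℕ) → f (v (suc i)) ≡ v i) × ((i : ℕ) → IsPeriodic f (v i))

-- Vertices of the finite tree t_i, written with depth relative to w_i:
-- (s , j) stands for the unroll-tree vertex (s , i + j).  It is a descendant of
-- w_i = (v i , i) iff f^j s = v i, and it lies in the subtree of
-- w_{i+1} = (v (i+1) , i+1) iff j = j' + 1 and f^j' s = v (i+1).
isVertex : ∀ {n} → (Fin n → Fin n) → (ℕ → Fin n) → ℕ → Fin n × ℕ → Bool
isVertex f v i (s , zero)  = ⌊ s ≟ v i ⌋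
isVertex f v i (s , suc j) =
  ⌊ iter f (suc j) s ≟ v i ⌋ ∧ not ⌊ iter f j s ≟ v (suc i) ⌋

Vertex : ∀ {n} → (Fin n → Fin n) → (ℕ → Fin n) → ℕ → Set
Vertex f v i = Σ (Fin _ × ℕ) λ x → T (isVertex f v i x)

Arc : ∀ {n} {f : Fin n → Fin n} {v : ℕ → Fin n} {i k : ℕ} →
      Vertex f v i → Vertex f v k → Set
Arc {f = f} ((s , j) , _) ((s' , j') , _) = (f s ≡ s') × (j ≡ suc j')

-- Isomorphism of the (rooted) trees t_i and t_k: a bijection of vertex sets
-- preserving and reflecting arcs (the root, the unique vertex without
-- outgoing arc, is then automatically preserved).
TreeIso : ∀ {n} → (Fin n → Fin n) → (ℕ → Fin n) → ℕ → ℕ → Set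
TreeIso f v i k =
  Σ (Vertex f v i → Vertex f v k) λ φ →
  Σ (Vertex f v k → Vertex f v i) λ ψ →
    ((x : Vertex f v i) → proj₁ (ψ (φ x)) ≡ proj₁ x) ×
    ((y : Vertex f v k) → proj₁ (φ (ψ y)) ≡ proj₁ y) ×
    ((x y : Vertex f v i) → Arc {f = f} {v = v} x y ⇔ Arc {f = f} {v = v} (φ x) (φ y))

HasPeriodicPattern : ∀ {n} → (Fin n → Fin n) → (ℕ → Fin n) → ℕ → Set
HasPeriodicPattern f v p =
  Σ (NonZero p) λ nz → (i : ℕ) → TreeIso f v i (_%_ i p {{nz}})

-- The trees t_i of an unroll tree, compared up to isomorphism, form a sequence
-- indexed by ℕ with values in a setoid; a periodic pattern of size p is exactly
-- a period p of that sequence (t_(i+p) ≅ t_i for all i). Periods are closed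
-- under multiples and under differences, so by Bézout gcd p₁ p₂ is a period.
module Submission where

open import Defs
open import Level using (Level; 0ℓ)
open import Data.Nat using (ℕ; zero; suc; _+_; _*_; _%_; _/_; NonZero; ≢-nonZero; ≢-nonZero⁻¹)
open import Data.Nat.Properties using (+-assoc; +-comm; +-identityʳ)
open import Data.Nat.DivMod using ([m+n]%n≡m%n; m≡m%n+[m/n]*n)
open import Data.Nat.GCD using (gcd; gcd-GCD; gcd[m,n]≢0; module Bézout)
open import Data.Fin using (Fin)
open import Data.Bool.Properties using (T-irrelevant)
open import Data.Product using (_,_; proj₁)
open import Data.Sum using (inj₁)
open import Function using (id; _∘_)
open import Function.Bundles using (_⇔_)
open import Function.Construct.Identity using (⇔-id)
open import Function.Construct.Symmetry using (⇔-sym)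
open import Function.Construct.Composition using (_⇔-∘_)
open import Relation.Binary.Bundles using (Setoid)
open import Relation.Binary.Structures using (IsEquivalence)
import Relation.Binary.Reasoning.Setoid as SetoidReasoning
open import Relation.Binary.PropositionalEquality as ≡ using (_≡_; refl; cong)

module Periods {ℓ : Level} {_≈_ : ℕ → ℕ → Set ℓ} (≈-isEquivalence : IsEquivalence _≈_) where

  private
    setoid : Setoid 0ℓ ℓ
    setoid = record { isEquivalence = ≈-isEquivalence }

  open Setoid setoid using (reflexive)
  open SetoidReasoning setoid

  IsPeriod : ℕ → Set ℓ
  IsPeriod p = ∀ i → (i + p) ≈ i

  isPeriod-* : ∀ {p} → IsPeriod p → ∀ k → IsPeriod (k * p)
  isPeriod-* P zero        i = reflexive (+-identityʳ i)
  isPeriod-* {p} P (suc k) i = begin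
    i + (p + k * p)  ≡⟨ cong (i +_) (+-comm p (k * p)) ⟩
    i + (k * p + p)  ≡⟨ ≡.sym (+-assoc i (k * p) p) ⟩
    i + k * p + p    ≈⟨ P (i + k * p) ⟩
    i + k * p        ≈⟨ isPeriod-* P k i ⟩
    i                ∎

  isPeriod-∸ : ∀ {a b d} → IsPeriod a → IsPeriod b → d + b ≡ a → IsPeriod d
  isPeriod-∸ {a} {b} {d} A B d+b≡a i = begin
    i + d        ≈⟨ B (i + d) ⟨
    i + d + b    ≡⟨ +-assoc i d b ⟩
    i + (d + b)  ≡⟨ cong (i +_) d+b≡a ⟩
    i + a        ≈⟨ A i ⟩
    i            ∎

  isPeriod-gcd : ∀ {p₁ p₂} → IsPeriod p₁ → IsPeriod p₂ → IsPeriod (gcd p₁ p₂)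
  isPeriod-gcd {p₁} {p₂} P₁ P₂ with Bézout.identity (gcd-GCD p₁ p₂)
  ... | Bézout.+- x y eq = isPeriod-∸ (isPeriod-* P₁ x) (isPeriod-* P₂ y) eq
  ... | Bézout.-+ x y eq = isPeriod-∸ (isPeriod-* P₂ y) (isPeriod-* P₁ x) eq

  isPeriod⇒≈-% : ∀ {p} .{{_ : NonZero p}} → IsPeriod p → ∀ i → i ≈ (i % p)
  isPeriod⇒≈-% {p} P i = begin
    i                    ≡⟨ m≡m%n+[m/n]*n i p ⟩
    i % p + (i / p) * p  ≈⟨ isPeriod-* P (i / p) (i % p) ⟩
    i % p                ∎

  ≈-%⇒isPeriod : ∀ {p} .{{_ : NonZero p}} → (∀ i → i ≈ (i % p)) → IsPeriod p
  ≈-%⇒isPeriod {p} R i = begin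
    i + p          ≈⟨ R (i + p) ⟩
    (i + p) % p    ≡⟨ [m+n]%n≡m%n i p ⟩
    i % p          ≈⟨ R i ⟨
    i              ∎

module _ {n : ℕ} {f : Fin n → Fin n} {v : ℕ → Fin n} where

  private
    _⟶_ : ∀ {i k} → Vertex f v i → Vertex f v k → Set
    _⟶_ = Arc {f = f} {v = v}

  vertex-≡ : ∀ {i} (x y : Vertex f v i) → proj₁ x ≡ proj₁ y → x ≡ y
  vertex-≡ (s , t) (.s , t′) refl = cong (s ,_) (T-irrelevant t t′)

  ⟶-cong : ∀ {i k} {x x′ : Vertex f v i} {y y′ : Vertex f v k} →
           x ≡ x′ → y ≡ y′ → (x ⟶ y) ⇔ (x′ ⟶ y′)
  ⟶-cong refl refl = ⇔-id _

  treeIso-refl : ∀ {i} → TreeIso f v i i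
  treeIso-refl = id , id , (λ _ → refl) , (λ _ → refl) , λ _ _ → ⇔-id _

  treeIso-sym : ∀ {i k} → TreeIso f v i k → TreeIso f v k i
  treeIso-sym {i} {k} (φ , ψ , ψφ , φψ , arcs) = ψ , φ , φψ , ψφ , arcs′
    where
    -- Vertex f v i does not determine i, hence the explicit indices.
    arcs′ : (x y : Vertex f v k) → _⟶_ {k} {k} x y ⇔ _⟶_ {i} {i} (ψ x) (ψ y)
    arcs′ x y = ⇔-sym (⟶-cong (vertex-≡ (φ (ψ x)) x (φψ x)) (vertex-≡ (φ (ψ y)) y (φψ y))
                        ⇔-∘ arcs (ψ x) (ψ y))

  treeIso-trans : ∀ {i j k} → TreeIso f v i j → TreeIso f v j k → TreeIso f v i k
  treeIso-trans (φ , ψ , ψφ , φψ , arcs) (φ′ , ψ′ , ψφ′ , φψ′ , arcs′) =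
    φ′ ∘ φ , ψ ∘ ψ′ ,
    (λ x → ≡.trans (cong (proj₁ ∘ ψ) (vertex-≡ (ψ′ (φ′ (φ x))) (φ x) (ψφ′ (φ x)))) (ψφ x)) ,
    (λ y → ≡.trans (cong (proj₁ ∘ φ′) (vertex-≡ (φ (ψ (ψ′ y))) (ψ′ y) (φψ (ψ′ y)))) (φψ′ y)) ,
    λ x y → arcs′ (φ x) (φ y) ⇔-∘ arcs x y

  treeIso-isEquivalence : IsEquivalence (TreeIso f v)
  treeIso-isEquivalence = record
    { refl = treeIso-refl ; sym = treeIso-sym ; trans = treeIso-trans }

open module TreePeriods {n} {f : Fin n → Fin n} {v : ℕ → Fin n} =
  Periods (treeIso-isEquivalence {n} {f} {v})

lemma12 : (n : ℕ) (f : Fin n → Fin n) (u : Fin n) → IsPeriodic f u →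
          (v : ℕ → Fin n) → IsInfiniteBranch f u v →
          (p₁ p₂ : ℕ) → HasPeriodicPattern f v p₁ → HasPeriodicPattern f v p₂ →
          HasPeriodicPattern f v (gcd p₁ p₂)
lemma12 n f u _ v _ p₁ p₂ (nz₁ , pattern₁) (nz₂ , pattern₂) = nz , isPeriod⇒≈-% period
  where
  instance
    nz : NonZero (gcd p₁ p₂)
    nz = ≢-nonZero (gcd[m,n]≢0 p₁ p₂ (inj₁ (≢-nonZero⁻¹ p₁ {{nz₁}})))
  period : IsPeriod {f = f} {v = v} (gcd p₁ p₂)
  period = isPeriod-gcd (≈-%⇒isPeriod {{nz₁}} pattern₁) (≈-%⇒isPeriod {{nz₂}} pattern₂)
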